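{- If a $(v,k,\lambda)$-BIBD admits a $0$-ULSE $\ell$-colouring with $\ell<v$, then \[2(\ell-1)\leq k\leq (\ell-1)(\ell-2).\]
   Context: For positive integers $v,k,\lambda$ with $2\le k<v$, a $(v,k,\lambda)$-BIBD is a pair $(V,\mathcal{B})$ where $V$ is a set of $v$ points and $\mathcal{B}$ is a collection of $k$-element subsets of $V$ (blocks) such that every pair of distinct points lies in exactly $\lambda$ blocks. An $\ell$-colouring is a surjective map from $V$ onto a set of $\ell$ colours. A $0$-ULSE $\ell$-colouring is an $\ell$-colouring such that $(\ell-1)$ divides $k$ and in every block exactly one colour does not appear, while each of the other $\ell-1$ colours appears exactly $\frac{k}{\ell-1}$ times in that block. It is nontrivial if $\ell<v$. -}

module Defs where

open import Data.Nat using (ℕ; zero; suc; _+_; _*_; _∸_; _≤_; _<_)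
open import Data.Nat.Divisibility using (_∣_)
open import Data.Bool using (Bool; true; false; _∧_; if_then_else_)
open import Data.Fin using (Fin)
open import Data.Fin.Subset using (Subset; _∈_) renaming (∣_∣ to size)
open import Data.Fin.Subset.Properties using (_∈?_)
open import Data.Fin.Properties using () renaming (_≟_ to _≟ᶠ_)
open import Data.List using (List; length; filter)
open import Data.List.Relation.Unary.All using (All)
open import Data.Product using (Σ; ∃; _×_; _,_)
open import Data.Sum using (_⊎_)
open import Relation.Binary.PropositionalEquality using (_≡_; _≢_)
open import Relation.Nullary using (¬_)
open import Relation.Nullary.Decidable using (⌊_⌋)
open import Function.Definitions using (Surjective)

-- Points of the design are Fin v; a block is a subset of Fin v;
-- the block collection is a List (multiset: repeated blocks allowed).

pairCount : ∀ {v} → List (Subset v) → Fin v → Fin v → ℕ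
pairCount Bs x y = length (filter (λ B → ⌊ x ∈? B ⌋ ∧ ⌊ y ∈? B ⌋ Data.Bool.≟ true) Bs)
  where import Data.Bool

record IsBIBD (v k lam : ℕ) (Bs : List (Subset v)) : Set where
  field
    two≤k   : 2 ≤ k
    k<v     : k < v
    λ-pos   : 1 ≤ lam
    blockSize : All (λ B → size B ≡ k) Bs
    balanced  : ∀ (x y : Fin v) → x ≢ y → pairCount Bs x y ≡ lam

colourClass : ∀ {v ℓ} → (Fin v → Fin ℓ) → Fin ℓ → Subset v
colourClass {v} c j = Data.Vec.tabulate (λ x → ⌊ c x ≟ᶠ j ⌋)
  where import Data.Vec

colourCount : ∀ {v ℓ} → (Fin v → Fin ℓ) → Subset v → Fin ℓ → ℕ
colourCount c B j = size (B Data.Fin.Subset.∩ colourClass c j)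
  where import Data.Fin.Subset

IsColouring : ∀ {v ℓ} → (Fin v → Fin ℓ) → Set
IsColouring {v} {ℓ} c = Surjective _≡_ _≡_ c

-- We phrase "k/(ℓ-1)" as a
-- number m with (ℓ-1)*m ≡ k (which is equivalent to divisibility plus the
-- quotient, and avoids a NonZero side condition).
record IsZeroULSE (v k ℓ : ℕ) (Bs : List (Subset v)) (c : Fin v → Fin ℓ) : Set where
  field
    colouring : IsColouring c
    divides   : (ℓ ∸ 1) ∣ k
    perBlock  : All (λ B → Σ (Fin ℓ) λ j →
                  (colourCount c B j ≡ 0) ×
                  (∀ i → i ≢ j → (ℓ ∸ 1) * colourCount c B i ≡ k)) Bs

-- Let m = k/(ℓ − 1) and fix a point x with replication number r. A block through x
-- contains the colour of x, so that colour is not the absent one and the block meets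
-- the colour class of x (of size n) in exactly m points. Counting the pairs (block, point)
-- through x inside that class gives r (m − 1) = λ (n − 1), next to the usual
-- r (k − 1) = λ (v − 1). As ℓ < v some class has n ≥ 2, forcing m ≥ 2, i.e. k ≥ 2(ℓ − 1).
-- A smallest class has ℓ n ≤ v, and then
-- r (m (ℓ − 1) − 1) = λ (v − 1) ≥ ℓ λ (n − 1) + λ (ℓ − 1) > ℓ r (m − 1),
-- which forces m < ℓ − 1, i.e. k ≤ (ℓ − 1)(ℓ − 2).
module Submission where

open import Defs
open import Data.Nat.Properties hiding (_≟_)
open import Algebra.Properties.Semiring.Sum +-*-semiring
  using (sum; sum-syntax; ∑-comm; ∑-distrib-+; *-distribˡ-sum; sum-cong-≗; sum-replicate-zero)
open import Data.Bool as Bool using (Bool; true; false; _∧_)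
open import Data.Bool.Properties using (∧-idem)
open import Data.Fin using (Fin; zero; suc; fromℕ<)
open import Data.Fin.Properties using (_≟_)
open import Data.Fin.Subset using (Subset; _∩_) renaming (∣_∣ to size)
open import Data.Fin.Subset.Properties using (_∈?_)
open import Data.List as List using (List; []; _∷_; length; filter)
open import Data.List.Membership.Propositional.Properties using (∈-lookup)
open import Data.List.Relation.Unary.All as All using (All)
open import Data.Nat using (ℕ; zero; suc; _+_; _*_; _∸_; _≤_; _<_; z≤n; z<s; _≤?_; >-nonZero)
open import Data.Nat.Divisibility using (_∣_)
open import Data.Nat.Tactic.RingSolver using (solve-∀)
open import Data.Product using (∃; _×_; _,_; proj₁; proj₂)
open import Data.Vec using (lookup; []; _∷_)
open import Data.Vec.Properties using (lookup-zipWith; lookup∘tabulate)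
open import Relation.Binary.PropositionalEquality
open import Relation.Nullary using (yes; no; contradiction)
open import Relation.Nullary.Decidable using (⌊_⌋; ⌊⌋-map′; isYes≗does; dec-true)

𝟙 : Bool → ℕ
𝟙 true  = 1
𝟙 false = 0

𝟙-∧ : ∀ a b → 𝟙 (a ∧ b) ≡ 𝟙 a * 𝟙 b
𝟙-∧ true  b = sym (*-identityˡ (𝟙 b))
𝟙-∧ false b = refl

∑-const : ∀ n a → ∑[ i < n ] a ≡ n * a
∑-const zero    a = refl
∑-const (suc n) a = cong (a +_) (∑-const n a)

∑-1 : ∀ n → ∑[ i < n ] 1 ≡ n
∑-1 n = trans (∑-const n 1) (*-identityʳ n)

∑-mono-≤ : ∀ {n} {f g : Fin n → ℕ} → (∀ i → f i ≤ g i) → sum f ≤ sum g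
∑-mono-≤ {zero}  f≤g = z≤n
∑-mono-≤ {suc n} f≤g = +-mono-≤ (f≤g zero) (∑-mono-≤ (λ i → f≤g (suc i)))

∑-term-≤ : ∀ {n} (f : Fin n → ℕ) i → f i ≤ sum f
∑-term-≤ f zero    = m≤m+n (f zero) _
∑-term-≤ f (suc i) = ≤-trans (∑-term-≤ (λ j → f (suc j)) i) (m≤n+m _ (f zero))

∑-δ : ∀ {n} (i : Fin n) → ∑[ j < n ] 𝟙 ⌊ i ≟ j ⌋ ≡ 1
∑-δ {suc n} zero    = cong suc (sum-replicate-zero n)
∑-δ {suc n} (suc i) = trans (sum-cong-≗ λ j → cong 𝟙 (⌊⌋-map′ _ _ (i ≟ j))) (∑-δ i)

∑-pigeonhole : ∀ {n} (f : Fin n → ℕ) → n < sum f → ∃ λ i → 1 < f i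
∑-pigeonhole {suc n} f n<∑f with 2 ≤? f zero
... | yes 1<f₀ = zero , 1<f₀
... | no  f₀≰1 =
  let i , 1<fᵢ = ∑-pigeonhole (λ i → f (suc i))
                   (+-cancelˡ-< 1 _ _ (<-≤-trans n<∑f (+-monoˡ-≤ _ (≤-pred (≰⇒> f₀≰1)))))
  in suc i , 1<fᵢ

∃-minimiser : ∀ {n} (f : Fin n → ℕ) → Fin n → ∃ λ i → ∀ j → f i ≤ f j
∃-minimiser {suc zero}    f _ = zero , λ { zero → ≤-refl }
∃-minimiser {suc (suc n)} f _ with ∃-minimiser (λ i → f (suc i)) zero
... | i , min with f zero ≤? f (suc i)
...   | yes f₀≤fᵢ = zero  , λ { zero → ≤-refl ; (suc j) → ≤-trans f₀≤fᵢ (min j) }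
...   | no  f₀≰fᵢ = suc i , λ { zero → <⇒≤ (≰⇒> f₀≰fᵢ) ; (suc j) → min j }

χ : ∀ {n} → Subset n → Fin n → ℕ
χ p y = 𝟙 (lookup p y)

size≡∑χ : ∀ {n} (p : Subset n) → size p ≡ ∑[ y < n ] χ p y
size≡∑χ []          = refl
size≡∑χ (true ∷ p)  = cong suc (size≡∑χ p)
size≡∑χ (false ∷ p) = size≡∑χ p

χ-∩ : ∀ {n} (p q : Subset n) y → χ (p ∩ q) y ≡ χ p y * χ q y
χ-∩ p q y = trans (cong 𝟙 (lookup-zipWith _∧_ y p q)) (𝟙-∧ (lookup p y) (lookup q y))

χ-idem : ∀ {n} (p : Subset n) y → χ p y * χ p y ≡ χ p y
χ-idem p y = trans (sym (𝟙-∧ (lookup p y) (lookup p y))) (cong 𝟙 (∧-idem (lookup p y)))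

⌊≟⌋-refl : ∀ {n} (i : Fin n) → ⌊ i ≟ i ⌋ ≡ true
⌊≟⌋-refl i = trans (isYes≗does (i ≟ i)) (dec-true (i ≟ i) refl)

⌊∈?⌋≡lookup : ∀ {n} (x : Fin n) (p : Subset n) → ⌊ x ∈? p ⌋ ≡ lookup p x
⌊∈?⌋≡lookup zero    (true  ∷ p) = refl
⌊∈?⌋≡lookup zero    (false ∷ p) = refl
⌊∈?⌋≡lookup (suc x) (_     ∷ p) = trans (⌊⌋-map′ _ _ (x ∈? p)) (⌊∈?⌋≡lookup x p)

length-filter≡∑ : ∀ {A : Set} (f : A → Bool) (xs : List A) →
  length (filter (λ a → f a Bool.≟ true) xs) ≡ ∑[ i < length xs ] 𝟙 (f (List.lookup xs i))
length-filter≡∑ f []       = refl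
length-filter≡∑ f (a ∷ xs) with f a
... | true  = cong suc (length-filter≡∑ f xs)
... | false = length-filter≡∑ f xs

module Incidence {v b} (B : Fin b → Subset v) where

  replication : Fin v → ℕ
  replication x = ∑[ β < b ] χ (B β) x

  coincidence : Fin v → Fin v → ℕ
  coincidence x y = ∑[ β < b ] (χ (B β) x * χ (B β) y)

  coincidence-diag : ∀ x → coincidence x x ≡ replication x
  coincidence-diag x = sum-cong-≗ λ β → χ-idem (B β) x

  ∑-weighted-coincidence : ∀ x (W : Fin v → ℕ) →
    ∑[ y < v ] (W y * coincidence x y) ≡ ∑[ β < b ] (χ (B β) x * ∑[ y < v ] (χ (B β) y * W y))
  ∑-weighted-coincidence x W = begin
    ∑[ y < v ] (W y * coincidence x y)
      ≡⟨ sum-cong-≗ (λ y → *-distribˡ-sum (W y) (λ β → χ (B β) x * χ (B β) y)) ⟩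
    ∑[ y < v ] ∑[ β < b ] (W y * (χ (B β) x * χ (B β) y))
      ≡⟨ ∑-comm (λ y β → W y * (χ (B β) x * χ (B β) y)) ⟩
    ∑[ β < b ] ∑[ y < v ] (W y * (χ (B β) x * χ (B β) y))
      ≡⟨ sum-cong-≗ (λ β → sum-cong-≗ (λ y → reassoc (W y) (χ (B β) x) (χ (B β) y))) ⟩
    ∑[ β < b ] ∑[ y < v ] (χ (B β) x * (χ (B β) y * W y))
      ≡⟨ sum-cong-≗ (λ β → sym (*-distribˡ-sum (χ (B β) x) (λ y → χ (B β) y * W y))) ⟩
    ∑[ β < b ] (χ (B β) x * ∑[ y < v ] (χ (B β) y * W y)) ∎
    where
    open ≡-Reasoning
    reassoc : ∀ w p q → w * (p * q) ≡ p * (q * w)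
    reassoc = solve-∀

  balanced-count : ∀ {lam} x (W : Fin v → ℕ) → W x ≡ 1 →
    (∀ y → x ≢ y → coincidence x y ≡ lam) →
    ∑[ β < b ] (χ (B β) x * ∑[ y < v ] (χ (B β) y * W y)) + lam ≡ lam * sum W + replication x
  balanced-count {lam} x W Wx≡1 balanced = begin
    ∑[ β < b ] (χ (B β) x * ∑[ y < v ] (χ (B β) y * W y)) + lam
      ≡⟨ cong₂ _+_ (sym (∑-weighted-coincidence x W))
                   (sym (trans (cong (lam *_) (∑-δ x)) (*-identityʳ lam))) ⟩
    ∑[ y < v ] (W y * coincidence x y) + lam * ∑[ y < v ] δ y
      ≡⟨ cong (_ +_) (*-distribˡ-sum lam δ) ⟩
    ∑[ y < v ] (W y * coincidence x y) + ∑[ y < v ] (lam * δ y)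
      ≡⟨ ∑-distrib-+ (λ y → W y * coincidence x y) (λ y → lam * δ y) ⟨
    ∑[ y < v ] (W y * coincidence x y + lam * δ y)
      ≡⟨ sum-cong-≗ split-diagonal ⟩
    ∑[ y < v ] (lam * W y + replication x * δ y)
      ≡⟨ ∑-distrib-+ (λ y → lam * W y) (λ y → replication x * δ y) ⟩
    ∑[ y < v ] (lam * W y) + ∑[ y < v ] (replication x * δ y)
      ≡⟨ cong₂ _+_ (*-distribˡ-sum lam W) (*-distribˡ-sum (replication x) δ) ⟨
    lam * sum W + replication x * ∑[ y < v ] δ y
      ≡⟨ cong (λ s → lam * sum W + replication x * s) (∑-δ x) ⟩
    lam * sum W + replication x * 1
      ≡⟨ cong (lam * sum W +_) (*-identityʳ (replication x)) ⟩
    lam * sum W + replication x ∎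
    where
    open ≡-Reasoning
    δ : Fin v → ℕ
    δ y = 𝟙 ⌊ x ≟ y ⌋
    split-diagonal : ∀ y → W y * coincidence x y + lam * δ y ≡ lam * W y + replication x * δ y
    split-diagonal y with x ≟ y
    ... | yes refl rewrite Wx≡1 | coincidence-diag x = on-diagonal (replication x) lam
      where
      on-diagonal : ∀ r l → 1 * r + l * 1 ≡ l * 1 + r * 1
      on-diagonal = solve-∀
    ... | no  x≢y  rewrite balanced y x≢y = off-diagonal (W y) lam (replication x)
      where
      off-diagonal : ∀ w l r → w * l + l * 0 ≡ l * w + r * 0
      off-diagonal = solve-∀

-- r (m − 1) = λ (n − 1), written without truncated subtraction.
ReplicationRelation : ℕ → ℕ → ℕ → ℕ → Set
ReplicationRelation m n r lam = m * r + lam ≡ lam * n + r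

ReplicationRelation⇒0<m*r : ∀ {m n r lam} → 0 < lam → 1 < n →
  ReplicationRelation m n r lam → 0 < m * r
ReplicationRelation⇒0<m*r {m} {n} {r} {lam} 0<lam 1<n rel = +-cancelʳ-< lam 0 (m * r) (begin-strict
  lam          <⟨ m<m*n lam n ⦃ >-nonZero 0<lam ⦄ 1<n ⟩
  lam * n      ≤⟨ m≤m+n (lam * n) r ⟩
  lam * n + r  ≡⟨ rel ⟨
  m * r + lam  ∎)
  where open ≤-Reasoning

ReplicationRelation⇒1<m : ∀ {m n r lam} → 0 < lam → 1 < n →
  ReplicationRelation m n r lam → 1 < m
ReplicationRelation⇒1<m {m} {n} {r} {lam} 0<lam 1<n rel =
  *-cancelʳ-< r 1 m (+-cancelʳ-< lam (1 * r) (m * r) (begin-strict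
    1 * r + lam  ≡⟨ cong (_+ lam) (*-identityˡ r) ⟩
    r + lam      <⟨ +-monoʳ-< r (m<m*n lam n ⦃ >-nonZero 0<lam ⦄ 1<n) ⟩
    r + lam * n  ≡⟨ +-comm r (lam * n) ⟩
    lam * n + r  ≡⟨ rel ⟨
    m * r + lam  ∎))
  where open ≤-Reasoning

ReplicationRelation⇒m<L : ∀ {m n r lam v L} → 0 < L → 0 < lam → suc L * n ≤ v →
  ReplicationRelation m n r lam → ReplicationRelation (m * L) v r lam → m < L
ReplicationRelation⇒m<L {m} {n} {r} {lam} {v} {L} 0<L 0<lam [1+L]n≤v relₙ relᵥ =
  *-cancelʳ-< r m L (begin-strict
    m * r            <⟨ m<m+n (m * r) (*-mono-< 0<L 0<lam) ⟩
    m * r + L * lam  ≤⟨ +-cancelʳ-≤ (m * L * r + lam + r) (m * r + L * lam) (L * r) counted ⟩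
    L * r            ∎)
  where
  open ≤-Reasoning
  counted : m * r + L * lam + (m * L * r + lam + r) ≤ L * r + (m * L * r + lam + r)
  counted = begin
    m * r + L * lam + (m * L * r + lam + r)  ≡⟨ expand m L r lam ⟩
    suc L * (m * r + lam) + r                ≡⟨ cong (λ t → suc L * t + r) relₙ ⟩
    suc L * (lam * n + r) + r                ≡⟨ regroup L lam n r ⟩
    lam * (suc L * n) + r + suc L * r        ≤⟨ +-monoˡ-≤ (suc L * r)
                                                  (+-monoˡ-≤ r (*-monoʳ-≤ lam [1+L]n≤v)) ⟩
    lam * v + r + suc L * r                  ≡⟨ cong (_+ suc L * r) relᵥ ⟨
    m * L * r + lam + suc L * r              ≡⟨ collect m L r lam ⟩
    L * r + (m * L * r + lam + r)            ∎
    where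
    expand : ∀ m L r lam → m * r + L * lam + (m * L * r + lam + r) ≡ suc L * (m * r + lam) + r
    expand = solve-∀
    regroup : ∀ L lam n r → suc L * (lam * n + r) + r ≡ lam * (suc L * n) + r + suc L * r
    regroup = solve-∀
    collect : ∀ m L r lam → m * L * r + lam + suc L * r ≡ L * r + (m * L * r + lam + r)
    collect = solve-∀

colourCount≡∑ : ∀ {v ℓ} (c : Fin v → Fin ℓ) (B : Subset v) j →
  colourCount c B j ≡ ∑[ y < v ] (χ B y * 𝟙 ⌊ c y ≟ j ⌋)
colourCount≡∑ c B j = trans (size≡∑χ (B ∩ colourClass c j)) (sum-cong-≗ λ y →
  trans (χ-∩ B (colourClass c j) y)
        (cong (λ b → χ B y * 𝟙 b) (lookup∘tabulate (λ z → ⌊ c z ≟ j ⌋) y)))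

colour-present : ∀ {v ℓ} (c : Fin v → Fin ℓ) (B : Subset v) x →
  lookup B x ≡ true → 0 < colourCount c B (c x)
colour-present {v} c B x x∈B = begin
  1                                   ≡⟨ cong₂ (λ p q → 𝟙 p * 𝟙 q) x∈B (⌊≟⌋-refl (c x)) ⟨
  χ B x * 𝟙 ⌊ c x ≟ c x ⌋             ≤⟨ ∑-term-≤ (λ y → χ B y * 𝟙 ⌊ c y ≟ c x ⌋) x ⟩
  ∑[ y < v ] (χ B y * 𝟙 ⌊ c y ≟ c x ⌋) ≡⟨ colourCount≡∑ c B (c x) ⟨
  colourCount c B (c x)               ∎
  where open ≤-Reasoning

module ZeroULSEDesign {v k lam ℓ} {Bs : List (Subset v)} {c : Fin v → Fin ℓ}
                      (bibd : IsBIBD v k lam Bs) (ulse : IsZeroULSE v k ℓ Bs c) where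
  open IsBIBD bibd
  open IsZeroULSE ulse renaming (divides to L∣k)
  open _∣_ L∣k renaming (quotient to m; equality to k≡m*L)

  L : ℕ
  L = ℓ ∸ 1

  block : Fin (length Bs) → Subset v
  block = List.lookup Bs

  open Incidence block

  every-block : ∀ {P : Subset v → Set} → All P Bs → ∀ β → P (block β)
  every-block ps β = All.lookup ps (∈-lookup β)

  pairCount≡coincidence : ∀ x y → pairCount Bs x y ≡ coincidence x y
  pairCount≡coincidence x y =
    trans (length-filter≡∑ (λ B → ⌊ x ∈? B ⌋ ∧ ⌊ y ∈? B ⌋) Bs) (sum-cong-≗ λ β →
      trans (cong₂ (λ p q → 𝟙 (p ∧ q)) (⌊∈?⌋≡lookup x (block β)) (⌊∈?⌋≡lookup y (block β)))
            (𝟙-∧ (lookup (block β) x) (lookup (block β) y)))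

  design-count : ∀ x (W : Fin v → ℕ) → W x ≡ 1 →
    ∑[ β < length Bs ] (χ (block β) x * ∑[ y < v ] (χ (block β) y * W y)) + lam
      ≡ lam * sum W + replication x
  design-count x W Wx≡1 = balanced-count x W Wx≡1 λ y x≢y →
    trans (sym (pairCount≡coincidence x y)) (balanced x y x≢y)

  replication-relation : ∀ x → ReplicationRelation k v (replication x) lam
  replication-relation x = begin
    k * replication x + lam
      ≡⟨ cong (_+ lam) (*-distribˡ-sum k (λ β → χ (block β) x)) ⟩
    ∑[ β < length Bs ] (k * χ (block β) x) + lam
      ≡⟨ cong (_+ lam) (sum-cong-≗ λ β →
           trans (*-comm k _) (cong (χ (block β) x *_) (block-size β))) ⟩
    ∑[ β < length Bs ] (χ (block β) x * ∑[ y < v ] (χ (block β) y * 1)) + lam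
      ≡⟨ design-count x (λ _ → 1) refl ⟩
    lam * ∑[ y < v ] 1 + replication x
      ≡⟨ cong (λ s → lam * s + replication x) (∑-1 v) ⟩
    lam * v + replication x ∎
    where
    open ≡-Reasoning
    block-size : ∀ β → k ≡ ∑[ y < v ] (χ (block β) y * 1)
    block-size β = trans (sym (every-block blockSize β))
      (trans (size≡∑χ (block β)) (sum-cong-≗ λ y → sym (*-identityʳ (χ (block β) y))))

  classSize : Fin ℓ → ℕ
  classSize i = ∑[ y < v ] 𝟙 ⌊ c y ≟ i ⌋

  ∑-classSize : sum classSize ≡ v
  ∑-classSize = begin
    ∑[ i < ℓ ] ∑[ y < v ] 𝟙 ⌊ c y ≟ i ⌋  ≡⟨ ∑-comm (λ i y → 𝟙 ⌊ c y ≟ i ⌋) ⟩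
    ∑[ y < v ] ∑[ i < ℓ ] 𝟙 ⌊ c y ≟ i ⌋  ≡⟨ sum-cong-≗ (λ y → ∑-δ (c y)) ⟩
    ∑[ y < v ] 1                        ≡⟨ ∑-1 v ⟩
    v                                   ∎
    where open ≡-Reasoning

  ownColourCount : Fin v → ℕ
  ownColourCount x = ∑[ β < length Bs ] (χ (block β) x * colourCount c (block β) (c x))

  ownColourCount-relation : ∀ x → ownColourCount x + lam ≡ lam * classSize (c x) + replication x
  ownColourCount-relation x = trans
    (cong (_+ lam) (sum-cong-≗ λ β → cong (χ (block β) x *_) (colourCount≡∑ c (block β) (c x))))
    (design-count x (λ y → 𝟙 ⌊ c y ≟ c x ⌋) (cong 𝟙 (⌊≟⌋-refl (c x))))

  present-colour-count : ∀ β x → lookup (block β) x ≡ true → L * colourCount c (block β) (c x) ≡ k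
  present-colour-count β x x∈β with every-block perBlock β
  ... | j , absent , present with c x ≟ j
  ...   | no  cx≢j = present (c x) cx≢j
  ...   | yes refl = contradiction absent (≢-sym (<⇒≢ (colour-present c (block β) x x∈β)))

  L*ownColourCount : ∀ x → L * ownColourCount x ≡ k * replication x
  L*ownColourCount x = begin
    L * ownColourCount x
      ≡⟨ *-distribˡ-sum L (λ β → χ (block β) x * colourCount c (block β) (c x)) ⟩
    ∑[ β < length Bs ] (L * (χ (block β) x * colourCount c (block β) (c x)))
      ≡⟨ sum-cong-≗ per-block ⟩
    ∑[ β < length Bs ] (k * χ (block β) x)
      ≡⟨ *-distribˡ-sum k (λ β → χ (block β) x) ⟨
    k * replication x ∎
    where
    open ≡-Reasoning
    per-block : ∀ β → L * (χ (block β) x * colourCount c (block β) (c x)) ≡ k * χ (block β) x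
    per-block β with lookup (block β) x in x∈β
    ... | false = trans (*-zeroʳ L) (sym (*-zeroʳ k))
    ... | true  = trans (cong (L *_) (*-identityˡ _))
                        (trans (present-colour-count β x x∈β) (sym (*-identityʳ k)))

  1<v : 1 < v
  1<v = <-trans two≤k k<v

  some-point : Fin v
  some-point = fromℕ< (<-trans z<s 1<v)

  0<L : 0 < L
  0<L = n≢0⇒n>0 λ L≡0 → <⇒≢ 0<k*r
    (trans (cong (_* ownColourCount some-point) (sym L≡0)) (L*ownColourCount some-point))
    where
    0<k*r : 0 < k * replication some-point
    0<k*r = ReplicationRelation⇒0<m*r {m = k} λ-pos 1<v (replication-relation some-point)

  ownColourCount≡m*r : ∀ x → ownColourCount x ≡ m * replication x
  ownColourCount≡m*r x =
    *-cancelˡ-≡ (ownColourCount x) (m * replication x) L ⦃ >-nonZero 0<L ⦄ (begin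
      L * ownColourCount x     ≡⟨ L*ownColourCount x ⟩
      k * replication x        ≡⟨ cong (_* replication x) k≡m*L ⟩
      m * L * replication x    ≡⟨ swap-factors m L (replication x) ⟩
      L * (m * replication x)  ∎)
    where
    open ≡-Reasoning
    swap-factors : ∀ m L r → m * L * r ≡ L * (m * r)
    swap-factors = solve-∀

  representative : Fin ℓ → Fin v
  representative i = proj₁ (colouring i)

  class-relation : ∀ i → ReplicationRelation m (classSize i) (replication (representative i)) lam
  class-relation i =
    subst (λ j → ReplicationRelation m (classSize j) (replication x) lam) (proj₂ (colouring i) refl)
          (trans (cong (_+ lam) (sym (ownColourCount≡m*r x))) (ownColourCount-relation x))
    where
    x : Fin v
    x = representative i

  large-class⇒2L≤k : ∀ i → 1 < classSize i → 2 * L ≤ k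
  large-class⇒2L≤k i 1<|i| = begin
    2 * L  ≤⟨ *-monoˡ-≤ L (ReplicationRelation⇒1<m {m = m} λ-pos 1<|i| (class-relation i)) ⟩
    m * L  ≡⟨ k≡m*L ⟨
    k      ∎
    where open ≤-Reasoning

  smallest-class⇒k≤L[ℓ∸2] : ∀ i → (∀ j → classSize i ≤ classSize j) → k ≤ L * (ℓ ∸ 2)
  smallest-class⇒k≤L[ℓ∸2] i minimal = begin
    k            ≡⟨ k≡m*L ⟩
    m * L        ≤⟨ *-monoˡ-≤ L (∸-monoˡ-≤ 1 m<L) ⟩
    (L ∸ 1) * L  ≡⟨ *-comm (L ∸ 1) L ⟩
    L * (L ∸ 1)  ≡⟨ cong (L *_) (∸-+-assoc ℓ 1 1) ⟩
    L * (ℓ ∸ 2)  ∎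
    where
    open ≤-Reasoning
    x : Fin v
    x = representative i
    ℓ-classes-fit : suc L * classSize i ≤ v
    ℓ-classes-fit = begin
      suc L * classSize i      ≡⟨ cong (_* classSize i) (m+[n∸m]≡n (≤-trans 0<L (m∸n≤m ℓ 1))) ⟩
      ℓ * classSize i          ≡⟨ ∑-const ℓ (classSize i) ⟨
      ∑[ j < ℓ ] classSize i   ≤⟨ ∑-mono-≤ minimal ⟩
      sum classSize            ≡⟨ ∑-classSize ⟩
      v                        ∎
    m<L : m < L
    m<L = ReplicationRelation⇒m<L {m = m} 0<L λ-pos ℓ-classes-fit (class-relation i)
      (subst (λ k → ReplicationRelation k v (replication x) lam) k≡m*L (replication-relation x))

lemma3p6 : (v k lam ℓ : ℕ) (Bs : List (Subset v)) (c : Fin v → Fin ℓ) →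
           IsBIBD v k lam Bs → IsZeroULSE v k ℓ Bs c → ℓ < v →
           (2 * (ℓ ∸ 1) ≤ k) × (k ≤ (ℓ ∸ 1) * (ℓ ∸ 2))
lemma3p6 v k lam ℓ Bs c bibd ulse ℓ<v =
  let large , 1<|large| = ∑-pigeonhole classSize (subst (ℓ <_) (sym ∑-classSize) ℓ<v)
      smallest , minimal = ∃-minimiser classSize (c some-point)
  in large-class⇒2L≤k large 1<|large| , smallest-class⇒k≤L[ℓ∸2] smallest minimal
  where open ZeroULSEDesign bibd ulse
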